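{- Let $P$ be a sum-indecomposable poset of height $k+2$ with $k\ge 0$, and let $Q_0,\dots,Q_k$ be its quarks. Then $P$ is $(\mathbf{3+1})$-avoiding if and only if for every $i\in\{0,\dots,k-1\}$ such that $P(i+1)$ contains no all-seeing element, either $Q_i$ has no isolated element in its lower part or $Q_{i+1}$ has no isolated element in its upper part (or both).
   Context: All posets are finite. A poset $P$ is weakly graded if there is $\operatorname{rk}:P\to\mathbb{N}$ with $\operatorname{rk}(b)=\operatorname{rk}(a)+1$ whenever $b$ covers $a$ and minimum rank $0$ on each connected component; it is strongly graded if moreover all minimal elements have equal rank and all maximal elements have equal rank. The height is the number of elements of a longest chain; $P(i)$ is the set of elements of rank $i$, so a strongly graded poset of height $k+2$ has ranks $0,\dots,k+1$. An element $v$ of rank $i$ is up-seeing if every element of $P(i+1)$ covers $v$, down-seeing if $v$ covers every element of $P(i-1)$ (vacuous if that set is empty), all-seeing if both; $P$ is vigilant if every element is up-seeing or down-seeing. A trimmed poset is a weakly graded vigilant poset in which each rank contains at most one all-seeing element (all-seeing elements unlabeled, others labeled by $[m]$). A nonempty strongly graded poset of height $h$ is sum-indecomposable if it is trimmed and there is no $i<h-1$ for which every element of $P(i)$ is up-seeing. For a sum-indecomposable $P$ of height $k+2$, its quark decomposition consists of $Q_0,\dots,Q_k$, where $Q_i$ is the induced subposet on $Q_i(0)\cup Q_i(1)$ with lower part $Q_i(0)$ equal to $P(0)$ if $i=0$ and to the set of non-up-seeing elements of $P(i)$ if $i\ge1$, and upper part $Q_i(1)$ equal to $P(k+1)$ if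 $i=k$ and to the set of non-down-seeing elements of $P(i+1)$ if $i<k$. An element $u\in Q_i(0)$ is isolated (in the lower part of $Q_i$) if it is below no element of $Q_i(1)$; an element $w\in Q_i(1)$ is isolated (in the upper part) if it is above no element of $Q_i(0)$. (In the paper's terminology, $Q_i$ and $Q_{i+1}$ are "stuck" rather than "glued" exactly when $P(i+1)$ has no all-seeing element.) A poset is $(\mathbf{3+1})$-avoiding if there are no four elements $x,y,z,w$ with $x<y<z$ and $w$ incomparable to each of $x,y,z$. -}

module Defs where

open import Data.Nat using (ℕ; zero; suc; _+_; _<_)
open import Data.Fin using (Fin)
open import Data.Product using (Σ; ∃; _×_; _,_)
open import Data.Sum using (_⊎_)
open import Relation.Nullary using (¬_; Dec)
open import Relation.Binary.PropositionalEquality using (_≡_)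
open import Relation.Binary.Construct.Closure.ReflexiveTransitive using (Star)

record FinPoset : Set₁ where
  field
    size     : ℕ
    _≺_      : Fin size → Fin size → Set
    ≺-irrefl : ∀ x → ¬ (x ≺ x)
    ≺-trans  : ∀ {x y z} → x ≺ y → y ≺ z → x ≺ z
    _≺?_     : ∀ x y → Dec (x ≺ y)

module _ (P : FinPoset) where
  open FinPoset P

  Elt : Set
  Elt = Fin size

  Covers : Elt → Elt → Set
  Covers b a = (a ≺ b) × (∀ c → ¬ ((a ≺ c) × (c ≺ b)))

  Minimal : Elt → Set
  Minimal x = ∀ y → ¬ (y ≺ x)

  Maximal : Elt → Set
  Maximal x = ∀ y → ¬ (x ≺ y)

  Comparable : Elt → Elt → Set
  Comparable a b = (a ≺ b) ⊎ (b ≺ a)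

  Connected : Elt → Elt → Set
  Connected = Star Comparable

  Incomparable : Elt → Elt → Set
  Incomparable a b = ¬ (a ≡ b) × ¬ (a ≺ b) × ¬ (b ≺ a)

  IsWeakRank : (Elt → ℕ) → Set
  IsWeakRank rk =
    (∀ a b → Covers b a → rk b ≡ suc (rk a)) ×
    (∀ x → ∃ λ y → Connected x y × rk y ≡ 0)

  IsStrongRank : (Elt → ℕ) → Set
  IsStrongRank rk =
    IsWeakRank rk ×
    (∀ x y → Minimal x → Minimal y → rk x ≡ rk y) ×
    (∀ x y → Maximal x → Maximal y → rk x ≡ rk y)

  HasChain : ℕ → Set
  HasChain m = Σ (Fin m → Elt) λ f → ∀ i j → Data.Fin._<_ i j → f i ≺ f j

  HasHeight : ℕ → Set
  HasHeight h = HasChain h × ¬ HasChain (suc h)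

  module _ (rk : Elt → ℕ) where

    UpSeeing : Elt → Set
    UpSeeing v = ∀ w → rk w ≡ suc (rk v) → Covers w v

    DownSeeing : Elt → Set
    DownSeeing v = ∀ u → suc (rk u) ≡ rk v → Covers v u

    AllSeeing : Elt → Set
    AllSeeing v = UpSeeing v × DownSeeing v

    Vigilant : Set
    Vigilant = ∀ v → UpSeeing v ⊎ DownSeeing v

    -- trimmed (the labels of non-all-seeing elements carry no order information)
    Trimmed : Set
    Trimmed = IsWeakRank rk × Vigilant ×
              (∀ x y → AllSeeing x → AllSeeing y → rk x ≡ rk y → x ≡ y)

    -- sum-indecomposable of height k+2 (nonemptiness follows from the height)
    SumIndecomposable : ℕ → Set
    SumIndecomposable k =
      IsStrongRank rk × HasHeight (suc (suc k)) × Trimmed ×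
      (∀ i → i < suc k → ¬ (∀ x → rk x ≡ i → UpSeeing x))

    QuarkLower : ℕ → Elt → Set
    QuarkLower zero    x = rk x ≡ 0
    QuarkLower (suc i) x = (rk x ≡ suc i) × ¬ UpSeeing x

    QuarkUpper : ℕ → ℕ → Elt → Set
    QuarkUpper k i w with Data.Nat._≟_ i k
    ... | Relation.Nullary.yes _ = rk w ≡ suc k
    ... | Relation.Nullary.no  _ = (rk w ≡ suc i) × ¬ DownSeeing w

    IsolatedLower : ℕ → ℕ → Elt → Set
    IsolatedLower k i u = QuarkLower i u × (∀ w → QuarkUpper k i w → ¬ (u ≺ w))

    IsolatedUpper : ℕ → ℕ → Elt → Set
    IsolatedUpper k i w = QuarkUpper k i w × (∀ u → QuarkLower i u → ¬ (u ≺ w))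

    QuarkCondition : ℕ → Set
    QuarkCondition k =
      ∀ i → i < k → (¬ ∃ λ v → rk v ≡ suc i × AllSeeing v) →
        (¬ ∃ (IsolatedLower k i)) ⊎ (¬ ∃ (IsolatedUpper k (suc i)))

  Avoids3+1 : Set
  Avoids3+1 = ¬ ∃ λ x → ∃ λ y → ∃ λ z → ∃ λ w →
    (x ≺ y) × (y ≺ z) × Incomparable w x × Incomparable w y × Incomparable w z

-- Ranks of a sum-indecomposable poset are tight: an up-seeing element lies below every
-- element of higher rank, and a down-seeing element above every element of lower rank.
-- If p ⊀ q with rk q = rk p + 2, then p is isolated in the lower part of Q_(rk p), q is
-- isolated in the upper part of Q_(rk p + 1), and no element of rank rk p + 1 is
-- all-seeing; so the quark condition makes all elements whose ranks differ by at least 2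
-- comparable.  An element w incomparable to x < y < z must then have rank rk x + 1 = rk z - 1,
-- and vigilance makes it comparable to x or to z.  Conversely, if u is isolated in the
-- lower part of Q_i and v in the upper part of Q_(i+1), a non-up-seeing b of rank i + 1
-- and any d covering b give u < b < d with v incomparable to all three; u ⊀ v because an
-- element strictly between them would be all-seeing.

module Submission where

open import Defs
open import Data.Nat using (ℕ; zero; suc; _+_; _≤_; _<_; z≤n; s≤s; _≟_)
open import Data.Nat.Properties
open import Data.Fin using (Fin; toℕ; inject≤) renaming (zero to fzero; suc to fsuc)
open import Data.Fin.Properties using (any?; all?; ¬∀⟶∃¬; toℕ-inject≤)
open import Data.Product using (∃; _×_; _,_; proj₁; proj₂)
open import Data.Sum using (_⊎_; inj₁; inj₂; [_,_]′)
open import Data.Empty using (⊥-elim)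
open import Relation.Nullary using (¬_; Dec; yes; no)
open import Relation.Nullary.Decidable using (_×-dec_; _→-dec_; ¬?; decidable-stable)
open import Relation.Binary.PropositionalEquality using (_≡_; _≢_; refl; sym; trans; cong; subst; subst₂)
open import Relation.Binary.Construct.Closure.Transitive using (TransClosure; [_]; _∷_; _++_)

¬→⇒×¬ : ∀ {A B : Set} → Dec A → ¬ (A → B) → A × ¬ B
¬→⇒×¬ A? ¬[A→B] = decidable-stable A? (λ ¬a → ¬[A→B] (λ a → ⊥-elim (¬a a))) , (λ b → ¬[A→B] (λ _ → b))

module FinPosetProperties (P : FinPoset) where
  open FinPoset P

  infix 4 _⋖_ _⋖⁺_ _≼_

  _⋖_ : Elt P → Elt P → Set
  a ⋖ b = Covers P b a

  _⋖⁺_ : Elt P → Elt P → Set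
  _⋖⁺_ = TransClosure _⋖_

  _≼_ : Elt P → Elt P → Set
  a ≼ b = a ≡ b ⊎ a ≺ b

  ≺-≼-trans : ∀ {a b c} → a ≺ b → b ≼ c → a ≺ c
  ≺-≼-trans ab (inj₁ refl) = ab
  ≺-≼-trans ab (inj₂ bc)   = ≺-trans ab bc

  witness : {Q : Elt P → Set} → (∀ x → Dec (Q x)) → ¬ (∀ x → ¬ Q x) → ∃ Q
  witness Q? ¬none with any? Q?
  ... | yes q  = q
  ... | no ¬q = ⊥-elim (¬none λ x qx → ¬q (x , qx))

  counterexample : {Q R : Elt P → Set} → (∀ x → Dec (Q x)) → (∀ x → Dec (R x)) →
                   ¬ (∀ x → Q x → R x) → ∃ λ x → Q x × ¬ R x
  counterexample Q? R? ¬all with ¬∀⟶∃¬ size _ (λ x → Q? x →-dec R? x) ¬all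
  ... | x , ¬[Qx→Rx] = x , ¬→⇒×¬ (Q? x) ¬[Qx→Rx]

  ≼⇒≺ : ∀ {a b} → a ≢ b → a ≼ b → a ≺ b
  ≼⇒≺ a≢b (inj₁ a≡b) = ⊥-elim (a≢b a≡b)
  ≼⇒≺ a≢b (inj₂ a≺b) = a≺b

  covers? : ∀ b a → Dec (Covers P b a)
  covers? b a = (a ≺? b) ×-dec all? (λ c → ¬? ((a ≺? c) ×-dec (c ≺? b)))

  ≺-interpolate : ∀ {a b} → ¬ (a ⋖ b) → a ≺ b → ∃ λ c → a ≺ c × c ≺ b
  ≺-interpolate ¬ab ab = witness (λ c → (_ ≺? c) ×-dec (c ≺? _)) (λ none → ¬ab (ab , none))

  ⋖⁺⇒≺ : ∀ {a b} → a ⋖⁺ b → a ≺ b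
  ⋖⁺⇒≺ [ ab ]    = proj₁ ab
  ⋖⁺⇒≺ (ac ∷ cb) = ≺-trans (proj₁ ac) (⋖⁺⇒≺ cb)

  ⋖⁺-first : ∀ {a b} → a ⋖⁺ b → ∃ λ d → a ⋖ d × d ≼ b
  ⋖⁺-first [ ab ]    = _ , ab , inj₁ refl
  ⋖⁺-first (ac ∷ cb) = _ , ac , inj₂ (⋖⁺⇒≺ cb)

  ⋖⁺-last : ∀ {a b} → a ⋖⁺ b → ∃ λ d → d ⋖ b × a ≼ d
  ⋖⁺-last [ ab ]    = _ , ab , inj₁ refl
  ⋖⁺-last (ac ∷ cb) with ⋖⁺-last cb
  ... | d , db , cd = d , db , inj₂ (≺-≼-trans (proj₁ ac) cd)

  ⋖⁺⇒rank< : (rk : Elt P → ℕ) → (∀ a b → Covers P b a → rk b ≡ suc (rk a)) →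
             ∀ {a b} → a ⋖⁺ b → rk a < rk b
  ⋖⁺⇒rank< rk coverRank [ ab ]    = ≤-reflexive (sym (coverRank _ _ ab))
  ⋖⁺⇒rank< rk coverRank (ac ∷ cb) =
    <-trans (≤-reflexive (sym (coverRank _ _ ac))) (⋖⁺⇒rank< rk coverRank cb)

  HasChain-mono : ∀ {m n} → m ≤ n → HasChain P n → HasChain P m
  HasChain-mono m≤n (f , f-mono) =
    (λ i → f (inject≤ i m≤n)) ,
    (λ i j i<j → f-mono (inject≤ i m≤n) (inject≤ j m≤n)
                   (subst₂ _<_ (sym (toℕ-inject≤ i m≤n)) (sym (toℕ-inject≤ j m≤n)) i<j))

  infixr 5 _◅_
  data Chain : Elt P → Elt P → ℕ → Set where
    []  : ∀ {x} → Chain x x 0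
    _◅_ : ∀ {x y z n} → x ≺ y → Chain y z n → Chain x z (suc n)

  infixl 5 _▻_
  _▻_ : ∀ {x y z n} → Chain x y n → y ≺ z → Chain x z (suc n)
  []        ▻ yz = yz ◅ []
  (xw ◅ wy) ▻ yz = xw ◅ (wy ▻ yz)

  infixr 5 _◅◅_
  _◅◅_ : ∀ {x y z m n} → Chain x y m → Chain y z n → Chain x z (m + n)
  []        ◅◅ yz = yz
  (xw ◅ wy) ◅◅ yz = xw ◅ (wy ◅◅ yz)

  element : ∀ {x y n} → Chain x y n → Fin (suc n) → Elt P
  element {x} _  fzero    = x
  element (_ ◅ c) (fsuc i) = element c i

  head≼element : ∀ {x y n} (c : Chain x y n) i → x ≼ element c i
  head≼element c        fzero    = inj₁ refl
  head≼element (xw ◅ c) (fsuc i) = inj₂ (≺-≼-trans xw (head≼element c i))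

  element-increasing : ∀ {x y n} (c : Chain x y n) i j → toℕ i < toℕ j → element c i ≺ element c j
  element-increasing (xw ◅ c) fzero    (fsuc j) _         = ≺-≼-trans xw (head≼element c j)
  element-increasing (xw ◅ c) (fsuc i) (fsuc j) (s≤s i<j) = element-increasing c i j i<j

  Chain⇒HasChain : ∀ {x y n} → Chain x y n → HasChain P (suc n)
  Chain⇒HasChain c = element c , element-increasing c

  module HeightBound (h : ℕ) (noLongChain : ¬ HasChain P (suc (suc h))) where

    chain-length≤ : ∀ {x y n} → Chain x y n → n ≤ h
    chain-length≤ c = ≮⇒≥ λ h<n → noLongChain (HasChain-mono (s≤s h<n) (Chain⇒HasChain c))

    -- Interpolating between a and b terminates because every interpolation lengthens
    -- the chain s ⋯ a ≺ b ⋯ t, whose length is at most h.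
    refine : ∀ fuel {s a b t p q} → p + q + fuel ≡ h →
             Chain s a p → a ≺ b → Chain b t q → a ⋖⁺ b
    refine fuel {a = a} {b} {p = p} {q} eq sa ab bt with covers? b a
    ... | yes a⋖b = [ a⋖b ]
    ... | no ¬a⋖b with ≺-interpolate ¬a⋖b ab | fuel
    ...   | c , ac , cb | suc f = refine f eq₁ sa ac (cb ◅ bt) ++ refine f eq₂ (sa ▻ ac) cb bt
      where
        eq₁ : p + suc q + f ≡ h
        eq₁ = trans (cong (_+ f) (+-suc _ _)) (trans (sym (+-suc _ f)) eq)
        eq₂ : suc p + q + f ≡ h
        eq₂ = trans (sym (+-suc _ f)) eq
    ...   | c , ac , cb | zero = ⊥-elim (1+n≰n (≤-trans (n≤1+n _) tooLong))
      where
        tooLong : suc (suc (p + q)) ≤ p + q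
        tooLong = ≤-trans (chain-length≤ ((sa ▻ ac ▻ cb) ◅◅ bt)) (≤-reflexive (trans (sym eq) (+-identityʳ _)))

    ≺⇒⋖⁺ : ∀ {a b} → a ≺ b → a ⋖⁺ b
    ≺⇒⋖⁺ ab = refine h refl [] ab []

    maximal-above′ : ∀ fuel {s x n} → n + fuel ≡ h → Chain s x n → ∃ λ m → Maximal P m × x ≼ m
    maximal-above′ fuel {x = x} eq sx with any? (x ≺?_)
    ... | no nothing-above = x , (λ y xy → nothing-above (y , xy)) , inj₁ refl
    ... | yes (t , xt) with fuel
    ...   | zero = ⊥-elim (1+n≰n (≤-trans (chain-length≤ (sx ▻ xt)) (≤-reflexive (trans (sym eq) (+-identityʳ _)))))
    ...   | suc f with maximal-above′ f (trans (sym (+-suc _ f)) eq) (sx ▻ xt)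
    ...     | m , m-max , t≼m = m , m-max , inj₂ (≺-≼-trans xt t≼m)

    maximal-above : ∀ x → ∃ λ m → Maximal P m × x ≼ m
    maximal-above x = maximal-above′ h refl []

module SumIndecomposablePoset (P : FinPoset) (k : ℕ) (rk : Elt P → ℕ)
                              (SI : SumIndecomposable P rk k) where
  open FinPoset P

  coverRank : ∀ a b → Covers P b a → rk b ≡ suc (rk a)
  coverRank = proj₁ (proj₁ (proj₁ SI))

  connectedToRank0 : ∀ x → ∃ λ y → Connected P x y × rk y ≡ 0
  connectedToRank0 = proj₂ (proj₁ (proj₁ SI))

  minimalRanksEqual : ∀ x y → Minimal P x → Minimal P y → rk x ≡ rk y
  minimalRanksEqual = proj₁ (proj₂ (proj₁ SI))

  maximalRanksEqual : ∀ x y → Maximal P x → Maximal P y → rk x ≡ rk y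
  maximalRanksEqual = proj₂ (proj₂ (proj₁ SI))

  longChain : HasChain P (suc (suc k))
  longChain = proj₁ (proj₁ (proj₂ SI))

  noLongerChain : ¬ HasChain P (suc (suc (suc k)))
  noLongerChain = proj₂ (proj₁ (proj₂ SI))

  vigilant : Vigilant P rk
  vigilant = proj₁ (proj₂ (proj₁ (proj₂ (proj₂ SI))))

  notAllUpSeeing : ∀ i → i < suc k → ¬ (∀ x → rk x ≡ i → UpSeeing P rk x)
  notAllUpSeeing = proj₂ (proj₂ (proj₂ SI))

  open FinPosetProperties P
  open HeightBound (suc k) noLongerChain

  AllSeeingAt : ℕ → Set
  AllSeeingAt r = ∃ λ c → rk c ≡ r × AllSeeing P rk c

  Up Down : Elt P → Set
  Up   = UpSeeing P rk
  Down = DownSeeing P rk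

  ≺⇒rank< : ∀ {a b} → a ≺ b → rk a < rk b
  ≺⇒rank< a≺b = ⋖⁺⇒rank< rk coverRank (≺⇒⋖⁺ a≺b)

  ≼⇒rank≤ : ∀ {a b} → a ≼ b → rk a ≤ rk b
  ≼⇒rank≤ (inj₁ refl) = ≤-refl
  ≼⇒rank≤ (inj₂ a≺b)  = <⇒≤ (≺⇒rank< a≺b)

  rank≤⇒⊀ : ∀ {a b} → rk b ≤ rk a → ¬ (a ≺ b)
  rank≤⇒⊀ b≤a a≺b = ≤⇒≯ b≤a (≺⇒rank< a≺b)

  incomparable-above : ∀ {w a} → rk a < rk w → ¬ (a ≺ w) → Incomparable P w a
  incomparable-above a<w a⊀w = (λ w≡a → <⇒≢ a<w (sym (cong rk w≡a))) , rank≤⇒⊀ (<⇒≤ a<w) , a⊀w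

  incomparable-sameRank : ∀ {w a} → rk w ≡ rk a → w ≢ a → Incomparable P w a
  incomparable-sameRank w~a w≢a = w≢a , rank≤⇒⊀ (≤-reflexive (sym w~a)) , rank≤⇒⊀ (≤-reflexive w~a)

  minimal⇒rank0 : ∀ x → Minimal P x → rk x ≡ 0
  minimal⇒rank0 x x-min with connectedToRank0 (proj₁ longChain fzero)
  ... | y , _ , y0 = trans (minimalRanksEqual x y x-min y-min) y0
    where
      y-min : Minimal P y
      y-min t = rank≤⇒⊀ (≤-trans (≤-reflexive y0) z≤n)

  chainTo : ∀ r x → rk x ≡ r → ∃ λ s → Chain s x r
  chainTo zero    x _  = x , []
  chainTo (suc r) x eq with witness (_≺? x) (λ x-min → 0≢1+n (trans (sym (minimal⇒rank0 x x-min)) eq))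
  ... | t , t≺x with ⋖⁺-last (≺⇒⋖⁺ t≺x)
  ...   | c , c⋖x , _ with chainTo r c (suc-injective (trans (sym (coverRank c x c⋖x)) eq))
  ...     | s , s⋯c = s , s⋯c ▻ proj₁ c⋖x

  rank≤ : ∀ x → rk x ≤ suc k
  rank≤ x = chain-length≤ (proj₂ (chainTo (rk x) x refl))

  <rank⇒≤k : ∀ {r b} → r < rk b → r ≤ k
  <rank⇒≤k {b = b} r<b = ≤-pred (≤-trans r<b (rank≤ b))

  up? : ∀ v → Dec (Up v)
  up? v = all? (λ w → (rk w ≟ suc (rk v)) →-dec covers? w v)

  down? : ∀ v → Dec (Down v)
  down? v = all? (λ u → (suc (rk u) ≟ rk v) →-dec covers? v u)

  ¬down⇒up : ∀ {v} → ¬ Down v → Up v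
  ¬down⇒up {v} ¬down = [ (λ up → up) , (λ down → ⊥-elim (¬down down)) ]′ (vigilant v)

  ¬up⇒down : ∀ {v} → ¬ Up v → Down v
  ¬up⇒down {v} ¬up = [ (λ up → ⊥-elim (¬up up)) , (λ down → down) ]′ (vigilant v)

  nonUpSeeing-at : ∀ {r} → r ≤ k → ∃ λ x → rk x ≡ r × ¬ Up x
  nonUpSeeing-at {r} r≤k = counterexample (λ x → rk x ≟ r) up? (notAllUpSeeing r (s≤s r≤k))

  nonDownSeeing-at : ∀ {r} → r ≤ k → ∃ λ w → rk w ≡ suc r × ¬ Down w
  nonDownSeeing-at r≤k with nonUpSeeing-at r≤k
  ... | e , refl , ¬up-e with counterexample (λ w → rk w ≟ suc (rk e)) (λ w → covers? w e) ¬up-e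
  ...   | w , rw , ¬w⋗e = w , rw , λ down-w → ¬w⋗e (down-w e (sym rw))

  maximal⇒rank≡1+k : ∀ {x} → Maximal P x → rk x ≡ suc k
  maximal⇒rank≡1+k {x} x-max with nonDownSeeing-at ≤-refl
  ... | w , rw , _ with maximal-above w
  ...   | m , m-max , w≼m = trans (maximalRanksEqual x m x-max m-max) (≤-antisym (rank≤ m) 1+k≤m)
    where
      1+k≤m : suc k ≤ rk m
      1+k≤m = ≤-trans (≤-reflexive (sym rw)) (≼⇒rank≤ w≼m)

  rank≤k⇒covered : ∀ {b} → rk b ≤ k → ∃ λ d → b ⋖ d
  rank≤k⇒covered {b} b≤k with witness (b ≺?_) ¬maximal
    where
      ¬maximal : ¬ Maximal P b
      ¬maximal b-max = 1+n≰n (≤-trans (≤-reflexive (sym (maximal⇒rank≡1+k b-max))) b≤k)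
  ... | t , b≺t with ⋖⁺-first (≺⇒⋖⁺ b≺t)
  ...   | d , b⋖d , _ = d , b⋖d

  upSeeing-below : ∀ {p q} → Up p → rk p < rk q → p ≺ q
  upSeeing-below {q = q} up-p p<q = let n , eq = m≤n⇒∃[o]m+o≡n p<q in go n up-p eq
    where
      go : ∀ n {p} → Up p → suc (rk p) + n ≡ rk q → p ≺ q
      go zero    up-p eq = proj₁ (up-p q (sym (trans (sym (+-identityʳ _)) eq)))
      go (suc n) {p} up-p eq with nonDownSeeing-at (<rank⇒≤k (≤-trans (m≤m+n _ (suc n)) (≤-reflexive eq)))
      ... | e , re , ¬down-e = ≺-trans (proj₁ (up-p e re)) (go n (¬down⇒up ¬down-e) e+n≡q)
        where
          e+n≡q : suc (rk e) + n ≡ rk q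
          e+n≡q = trans (cong (λ r → suc r + n) re) (trans (sym (+-suc _ n)) eq)

  downSeeing-above : ∀ {p q} → Down q → rk p < rk q → p ≺ q
  downSeeing-above {p} down-q p<q = let n , eq = m≤n⇒∃[o]m+o≡n p<q in go n down-q eq
    where
      go : ∀ n {q} → Down q → suc (rk p) + n ≡ rk q → p ≺ q
      go zero    down-q eq = proj₁ (down-q p (trans (sym (+-identityʳ _)) eq))
      go (suc n) {q} down-q eq with nonUpSeeing-at (<rank⇒≤k (≤-reflexive (sym e+1≡q)))
        where
          e+1≡q : rk q ≡ suc (suc (rk p) + n)
          e+1≡q = trans (sym eq) (+-suc _ n)
      ... | e , re , ¬up-e = ≺-trans (go n (¬up⇒down ¬up-e) (sym re)) (proj₁ (down-q e rq))
        where
          rq : suc (rk e) ≡ rk q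
          rq = trans (cong suc re) (trans (sym (+-suc _ n)) eq)

  quarkLower-rank : ∀ {i x} → QuarkLower P rk i x → rk x ≡ i
  quarkLower-rank {zero}  rx       = rx
  quarkLower-rank {suc i} (rx , _) = rx

  quarkLower-intro : ∀ {i x} → rk x ≡ i → ¬ Up x → QuarkLower P rk i x
  quarkLower-intro {zero}  rx _   = rx
  quarkLower-intro {suc i} rx ¬up = rx , ¬up

  quarkUpper-rank : ∀ {i w} → QuarkUpper P rk k i w → rk w ≡ suc i
  quarkUpper-rank {i} w-upper with i ≟ k
  ... | yes refl = w-upper
  ... | no  _    = proj₁ w-upper

  quarkUpper-¬down : ∀ {i w} → i ≢ k → QuarkUpper P rk k i w → ¬ Down w
  quarkUpper-¬down {i} i≢k w-upper with i ≟ k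
  ... | yes i≡k = ⊥-elim (i≢k i≡k)
  ... | no  _   = proj₂ w-upper

  quarkUpper-intro : ∀ {i w} → rk w ≡ suc i → ¬ Down w → QuarkUpper P rk k i w
  quarkUpper-intro {i} rw ¬down with i ≟ k
  ... | yes refl = rw
  ... | no  _    = rw , ¬down

  quarkLower? : ∀ i x → Dec (QuarkLower P rk i x)
  quarkLower? zero    x = rk x ≟ 0
  quarkLower? (suc i) x = (rk x ≟ suc i) ×-dec ¬? (up? x)

  quarkUpper? : ∀ i w → Dec (QuarkUpper P rk k i w)
  quarkUpper? i w with i ≟ k
  ... | yes _ = rk w ≟ suc k
  ... | no  _ = (rk w ≟ suc i) ×-dec ¬? (down? w)

  isolatedLower? : ∀ i u → Dec (IsolatedLower P rk k i u)
  isolatedLower? i u = quarkLower? i u ×-dec all? (λ w → quarkUpper? i w →-dec ¬? (u ≺? w))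

  module _ (quarkCondition : QuarkCondition P rk k) where

    rank+2⇒¬¬≺ : ∀ {p q} → rk q ≡ suc (suc (rk p)) → ¬ ¬ (p ≺ q)
    rank+2⇒¬¬≺ {p} {q} rq p⊀q =
      [ (λ noLower → noLower (p , quarkLower-intro refl ¬up-p , p-isolated))
      , (λ noUpper → noUpper (q , quarkUpper-intro rq ¬down-q , q-isolated))
      ]′ (quarkCondition (rk p) p<k noAllSeeing)
      where
        p<k : rk p < k
        p<k = <rank⇒≤k (≤-reflexive (sym rq))
        p<q : rk p < rk q
        p<q = ≤-trans (n≤1+n _) (≤-reflexive (sym rq))
        ¬up-p : ¬ Up p
        ¬up-p up = p⊀q (upSeeing-below up p<q)
        ¬down-q : ¬ Down q
        ¬down-q down = p⊀q (downSeeing-above down p<q)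
        noAllSeeing : ¬ AllSeeingAt (suc (rk p))
        noAllSeeing (e , re , up-e , down-e) =
          p⊀q (≺-trans (proj₁ (down-e p (sym re))) (proj₁ (up-e q (trans rq (cong suc (sym re))))))
        p-isolated : ∀ w → QuarkUpper P rk k (rk p) w → ¬ (p ≺ w)
        p-isolated w w-upper p≺w = p⊀q (≺-trans p≺w (proj₁ (up-w q (trans rq (cong suc (sym (quarkUpper-rank w-upper)))))))
          where
            up-w : Up w
            up-w = ¬down⇒up (quarkUpper-¬down (<⇒≢ p<k) w-upper)
        q-isolated : ∀ u → QuarkLower P rk (suc (rk p)) u → ¬ (u ≺ q)
        q-isolated u (ru , ¬up-u) u≺q = p⊀q (≺-trans (proj₁ (¬up⇒down ¬up-u p (sym ru))) u≺q)

    rank+2≤⇒≺ : ∀ {p q} → suc (rk p) < rk q → p ≺ q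
    rank+2≤⇒≺ {q = q} gap = let n , eq = m≤n⇒∃[o]m+o≡n gap in go n eq
      where
        go : ∀ n {p} → suc (suc (rk p)) + n ≡ rk q → p ≺ q
        go zero {p} eq = decidable-stable (p ≺? q) (rank+2⇒¬¬≺ (sym (trans (sym (+-identityʳ _)) eq)))
        go (suc n) {p} eq with nonUpSeeing-at (<rank⇒≤k (≤-trans (m≤m+n _ (suc n)) (≤-reflexive eq)))
        ... | u , ru , ¬up-u = ≺-trans (proj₁ (¬up⇒down ¬up-u p (sym ru))) (go n u+n≡q)
          where
            u+n≡q : suc (suc (rk u)) + n ≡ rk q
            u+n≡q = trans (cong (λ r → suc (suc r) + n) ru) (trans (sym (+-suc _ n)) eq)

    ⊀⇒rank≤1+ : ∀ {a b} → ¬ (a ≺ b) → rk b ≤ suc (rk a)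
    ⊀⇒rank≤1+ a⊀b = ≮⇒≥ λ gap → a⊀b (rank+2≤⇒≺ gap)

    quarkCondition⇒avoids3+1 : Avoids3+1 P
    quarkCondition⇒avoids3+1 (x , y , z , w , x≺y , y≺z , (_ , _ , x⊀w) , _ , (_ , w⊀z , _)) =
      [ (λ up-w → w⊀z (proj₁ (up-w z rz))) , (λ down-w → x⊀w (proj₁ (down-w x rw))) ]′ (vigilant w)
      where
        x+2≤z : suc (suc (rk x)) ≤ rk z
        x+2≤z = ≤-trans (s≤s (≺⇒rank< x≺y)) (≺⇒rank< y≺z)
        rz : rk z ≡ suc (rk w)
        rz = ≤-antisym (⊀⇒rank≤1+ w⊀z) (≤-trans (s≤s (⊀⇒rank≤1+ x⊀w)) x+2≤z)
        rw : suc (rk x) ≡ rk w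
        rw = ≤-antisym (≤-pred (≤-trans x+2≤z (⊀⇒rank≤1+ w⊀z))) (⊀⇒rank≤1+ x⊀w)

  isolatedPair⇒⊀ : ∀ {i u v} → ¬ AllSeeingAt (suc i) →
                   IsolatedLower P rk k i u → IsolatedUpper P rk k (suc i) v → ¬ (u ≺ v)
  isolatedPair⇒⊀ {i} {u} {v} noAllSeeing (u-lower , u-isolated) (v-upper , v-isolated) u≺v
    with ⋖⁺-first (≺⇒⋖⁺ u≺v)
  ... | c , u⋖c , c≼v = ¬¬up-c λ up → ¬¬down-c λ down → noAllSeeing (c , rc , up , down)
    where
      rc : rk c ≡ suc i
      rc = trans (coverRank u c u⋖c) (cong suc (quarkLower-rank u-lower))
      c≺v : c ≺ v
      c≺v = ≼⇒≺ (λ c≡v → <⇒≢ (n<1+n (suc i)) (trans (sym rc) (trans (cong rk c≡v) (quarkUpper-rank v-upper)))) c≼v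
      ¬¬down-c : ¬ ¬ Down c
      ¬¬down-c ¬down = u-isolated c (quarkUpper-intro rc ¬down) (proj₁ u⋖c)
      ¬¬up-c : ¬ ¬ Up c
      ¬¬up-c ¬up = v-isolated c (rc , ¬up) c≺v

  isolatedPair⇒¬avoids3+1 : ∀ {i u v b d} → ¬ AllSeeingAt (suc i) →
                            IsolatedLower P rk k i u → IsolatedUpper P rk k (suc i) v →
                            rk b ≡ suc i → ¬ Up b → b ⋖ d → ¬ Avoids3+1 P
  isolatedPair⇒¬avoids3+1 {i} {u} {v} {b} {d} noAllSeeing u-iso v-iso rb ¬up-b b⋖d avoids =
    avoids (u , b , d , v , u≺b , proj₁ b⋖d , v∥u , v∥b , v∥d)
    where
      ru : rk u ≡ i
      ru = quarkLower-rank (proj₁ u-iso)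
      rv : rk v ≡ suc (suc i)
      rv = quarkUpper-rank (proj₁ v-iso)
      u≺b : u ≺ b
      u≺b = proj₁ (¬up⇒down ¬up-b u (trans (cong suc ru) (sym rb)))
      b⊀v : ¬ (b ≺ v)
      b⊀v = proj₂ v-iso b (rb , ¬up-b)
      v∥u : Incomparable P v u
      v∥u = incomparable-above (subst₂ _<_ (sym ru) (sym rv) (<-trans (n<1+n i) (n<1+n (suc i))))
                               (isolatedPair⇒⊀ noAllSeeing u-iso v-iso)
      v∥b : Incomparable P v b
      v∥b = incomparable-above (subst₂ _<_ (sym rb) (sym rv) (n<1+n (suc i))) b⊀v
      v∥d : Incomparable P v d
      v∥d = incomparable-sameRank (trans rv (sym (trans (coverRank b d b⋖d) (cong suc rb))))
                                  (λ v≡d → b⊀v (subst (b ≺_) (sym v≡d) (proj₁ b⋖d)))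

  avoids3+1⇒quarkCondition : Avoids3+1 P → QuarkCondition P rk k
  avoids3+1⇒quarkCondition avoids i i<k noAllSeeing with any? (isolatedLower? i)
  ... | no  noLower     = inj₁ noLower
  ... | yes (u , u-iso) = inj₂ λ { (v , v-iso) →
    let b , rb , ¬up-b = nonUpSeeing-at i<k
        d , b⋖d        = rank≤k⇒covered (≤-trans (≤-reflexive rb) i<k)
    in isolatedPair⇒¬avoids3+1 noAllSeeing u-iso v-iso rb ¬up-b b⋖d avoids }

theorem4p9 : (P : FinPoset) (k : ℕ) (rk : Fin (FinPoset.size P) → ℕ) →
    SumIndecomposable P rk k →
    (Avoids3+1 P → QuarkCondition P rk k) × (QuarkCondition P rk k → Avoids3+1 P)
theorem4p9 P k rk SI = avoids3+1⇒quarkCondition , quarkCondition⇒avoids3+1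
  where open SumIndecomposablePoset P k rk SI
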